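{- If $G$ is a $\gamma_{tR}$-edge-supercritical graph with $\delta(G)\geq 2$, then $\gamma_{tR}(G-e)=\gamma_{tR}(G)$ for every edge $e\in E(G)$ (i.e., $G$ is $\gamma_{tR}$-ER-stable).
   Context: All graphs are finite and simple. A total Roman dominating function (TRD-function) on a graph $G$ with no isolated vertices is a function $f:V(G)\to\{0,1,2\}$ such that every vertex $v$ with $f(v)=0$ is adjacent to some $u$ with $f(u)=2$, and the subgraph induced by $\{w:f(w)>0\}$ has no isolated vertices; its weight is $\sum_v f(v)$ and $\gamma_{tR}(G)$ is the minimum weight. A graph $G$ with no isolated vertices is $\gamma_{tR}$-edge-supercritical if $E(\overline{G})\neq\emptyset$ and $\gamma_{tR}(G+e)\leq\gamma_{tR}(G)-2$ for every $e\in E(\overline{G})$. -}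

module Defs where

open import Data.Nat using (ℕ; _+_; _≤_; _<_)
open import Data.Fin using (Fin; toℕ; _≟_)
open import Data.Bool using (Bool; true; false; _∧_; _∨_; not)
open import Data.List using (List; map; allFin; filter; length)
open import Data.Nat.ListAction using (sum)
open import Data.Product using (Σ; ∃; _×_; _,_)
open import Relation.Nullary.Decidable using (⌊_⌋)
open import Relation.Binary.PropositionalEquality using (_≡_; _≢_)
open import Relation.Unary using (Decidable)

Graph : ℕ → Set
Graph n = Fin n → Fin n → Bool

record IsSimple {n : ℕ} (G : Graph n) : Set where
  field
    symm    : ∀ u v → G u v ≡ G v u
    irrefl  : ∀ v → G v v ≡ false

deg : ∀ {n} → Graph n → Fin n → ℕ
deg {n} G v = length (filter (λ w → G v w Data.Bool.≟ true) (allFin n))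

MinDegAtLeast : ∀ {n} → Graph n → ℕ → Set
MinDegAtLeast G k = ∀ v → k ≤ deg G v

addEdge : ∀ {n} → Graph n → Fin n → Fin n → Graph n
addEdge G u v x y =
  G x y ∨ (⌊ x ≟ u ⌋ ∧ ⌊ y ≟ v ⌋) ∨ (⌊ x ≟ v ⌋ ∧ ⌊ y ≟ u ⌋)

removeEdge : ∀ {n} → Graph n → Fin n → Fin n → Graph n
removeEdge G u v x y =
  G x y ∧ not ((⌊ x ≟ u ⌋ ∧ ⌊ y ≟ v ⌋) ∨ (⌊ x ≟ v ⌋ ∧ ⌊ y ≟ u ⌋))

Labelling : ℕ → Set
Labelling n = Fin n → Fin 3

val : ∀ {n} → Labelling n → Fin n → ℕ
val f v = toℕ (f v)

weight : ∀ {n} → Labelling n → ℕ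
weight {n} f = sum (map (val f) (allFin n))

record IsTRDF {n : ℕ} (G : Graph n) (f : Labelling n) : Set where
  field
    dominate : ∀ v → val f v ≡ 0 → ∃ λ u → G v u ≡ true × val f u ≡ 2
    total    : ∀ v → 0 < val f v → ∃ λ u → G v u ≡ true × 0 < val f u

IsγtR : ∀ {n} → Graph n → ℕ → Set
IsγtR {n} G k =
  (Σ (Labelling n) λ f → IsTRDF G f × weight f ≡ k)
  × (∀ (f : Labelling n) → IsTRDF G f → k ≤ weight f)

IsSupercritical : ∀ {n} → Graph n → Set
IsSupercritical {n} G =
  (Σ (Fin n) λ u → Σ (Fin n) λ v → u ≢ v × G u v ≡ false)
  × (∀ (u v : Fin n) → u ≢ v → G u v ≡ false →
       ∀ k k' → IsγtR G k → IsγtR (addEdge G u v) k' → k' + 2 ≤ k)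

-- Deleting an edge cannot lower γtR, so it suffices to find a TRD-function of G − uv of weight γtR(G) = k.
-- Supercriticality provides, for a non-edge ab chosen near uv, a TRD-function g of G + ab of weight at
-- most k − 2, and g can be repaired into a TRD-function of G − uv at cost at most two: raise two vertices
-- to at least 1, or one vertex to 2.  Which repair works depends on the values of g at a, b, u, v; when a
-- and b have a common neighbour, minimality of k forces g to vanish at exactly one end of ab.  The non-edge
-- is a neighbour of one end of uv that is not adjacent to the other, or two non-adjacent common neighbours
-- of u and v, or a common neighbour s together with a neighbour of s outside N[u].  If there is none, u, v
-- and a common neighbour s are pairwise closed twins; transposing twins is an automorphism, so some
-- γtR(G)-function is largest at s among u, v, s, and that function never needs the edge uv.
module Submission where

open import Defs
open import Data.Nat using (ℕ; zero; suc; _+_; _≤_; _<_; z≤n; s≤s; _<?_; _≤?_)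
import Data.Nat as ℕ
open import Data.Nat.Properties
  using (+-comm; +-assoc; +-suc; +-cancelʳ-≤; +-monoʳ-≤; +-monoˡ-≤; ≤-pred; ≤-refl; ≤-reflexive; ≤-trans;
         ≤-antisym; <-≤-trans; m≤n+m; m≤m+n; <⇒≱; <⇒≤; ≰⇒>; >⇒≢; module ≤-Reasoning; +-0-commutativeMonoid)
open import Data.Nat.ListAction using (sum)
open import Data.Fin using (Fin; toℕ; _≟_; punchIn; finToFun; funToFin)
open import Data.Fin.Patterns using (0F; 1F; 2F)
open import Data.Fin.Properties using (punchInᵢ≢i; toℕ<n; any?; all?; finToFun-funToFin)
open import Data.Fin.Permutation using (Permutation′; _⟨$⟩ʳ_; _⟨$⟩ˡ_; inverseʳ; transpose)
import Data.Fin.Permutation.Components as PC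
open import Data.Bool using (Bool; true; false; _∧_; _∨_; not)
import Data.Bool as Bool
open import Data.Bool.Properties using (T-≡; T-∨; T-∧; ∨-comm; ¬-not)
open import Data.List using (List; allFin; tabulate; filter; length)
open import Data.List.Properties using (map-tabulate)
open import Data.List.Relation.Unary.All as All using (All; []; _∷_)
open import Data.List.Relation.Unary.All.Properties using (all-filter)
open import Data.List.Relation.Unary.AllPairs using ([]; _∷_)
open import Data.List.Relation.Unary.Unique.Propositional using (Unique)
import Data.List.Relation.Unary.Unique.Propositional.Properties as Unique
open import Data.List.Membership.Propositional.Properties using (∈-filter⁺; ∈-tabulate⁺)
open import Data.List.Extrema.Nat using (argmin; argmin-all; f[argmin]≤f[xs])
open import Data.Vec.Functional using (updateAt)
open import Data.Vec.Functional.Properties using (updateAt-updates; updateAt-minimal)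
open import Data.Product using (∃; _×_; _,_; proj₁; proj₂)
open import Data.Sum using (_⊎_; inj₁; inj₂; [_,_])
open import Data.Empty using (⊥)
open import Function using (_∘_; id; const)
open import Function.Bundles using (Equivalence)
open import Relation.Nullary using (¬_; Dec; yes; no; contradiction; ¬?)
open import Relation.Nullary.Decidable
  using (⌊_⌋; toWitness; _×-dec_; _⊎-dec_; _→-dec_; map′; decidable-stable)
open import Relation.Binary.PropositionalEquality hiding ([_])
import Algebra.Properties.CommutativeMonoid.Sum +-0-commutativeMonoid as ∑

-- Labellings and their weights

val-updateAt-same : ∀ {n} (f : Labelling n) a (h : Fin 3 → Fin 3) → val (updateAt f a h) a ≡ toℕ (h (f a))
val-updateAt-same f a h = cong toℕ (updateAt-updates a f)

val-updateAt-other : ∀ {n} (f : Labelling n) {a x} (h : Fin 3 → Fin 3) →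
  x ≢ a → val (updateAt f a h) x ≡ val f x
val-updateAt-other f {a} {x} h x≢a = cong toℕ (updateAt-minimal x a f x≢a)

sum-tabulate : ∀ {n} (h : Fin n → ℕ) → sum (tabulate h) ≡ ∑.sum h
sum-tabulate {zero}  h = refl
sum-tabulate {suc n} h = cong (h 0F +_) (sum-tabulate (h ∘ Fin.suc))

weight≡∑ : ∀ {n} (f : Labelling n) → weight f ≡ ∑.sum (val f)
weight≡∑ f = trans (cong sum (map-tabulate id (val f))) (sum-tabulate (val f))

weight-≗ : ∀ {n} {f f′ : Labelling n} → f ≗ f′ → weight f ≡ weight f′
weight-≗ {f = f} {f′} f≗f′ = begin
  weight f        ≡⟨ weight≡∑ f ⟩
  ∑.sum (val f)   ≡⟨ ∑.sum-cong-≗ (cong toℕ ∘ f≗f′) ⟩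
  ∑.sum (val f′)  ≡⟨ weight≡∑ f′ ⟨
  weight f′       ∎
  where open ≡-Reasoning

weight-permute : ∀ {n} (f : Labelling n) (π : Permutation′ n) → weight (f ∘ (π ⟨$⟩ʳ_)) ≡ weight f
weight-permute f π = begin
  weight (f ∘ (π ⟨$⟩ʳ_))     ≡⟨ weight≡∑ (f ∘ (π ⟨$⟩ʳ_)) ⟩
  ∑.sum (val f ∘ (π ⟨$⟩ʳ_))  ≡⟨ ∑.sum-permute (val f) π ⟨
  ∑.sum (val f)              ≡⟨ weight≡∑ f ⟨
  weight f                   ∎
  where open ≡-Reasoning

weight-updateAt : ∀ {n} (f : Labelling n) a (h : Fin 3 → Fin 3) →
  weight (updateAt f a h) + val f a ≡ weight f + toℕ (h (f a))
weight-updateAt {suc n} f a h = begin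
  weight f′ + val f a                  ≡⟨ cong (_+ val f a) (weight≡∑ f′) ⟩
  ∑.sum (val f′) + val f a             ≡⟨ cong (_+ val f a) (∑.sum-remove {i = a} (val f′)) ⟩
  (val f′ a + rest f′) + val f a       ≡⟨ cong₂ (λ p q → (p + q) + val f a)
                                            (val-updateAt-same f a h) rest-same ⟩
  (toℕ (h (f a)) + rest f) + val f a   ≡⟨ swap-ends (toℕ (h (f a))) (rest f) (val f a) ⟩
  (val f a + rest f) + toℕ (h (f a))   ≡⟨ cong (_+ toℕ (h (f a))) (∑.sum-remove {i = a} (val f)) ⟨
  ∑.sum (val f) + toℕ (h (f a))        ≡⟨ cong (_+ toℕ (h (f a))) (weight≡∑ f) ⟨
  weight f + toℕ (h (f a))             ∎
  where
  open ≡-Reasoning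
  f′ = updateAt f a h
  rest : Labelling (suc n) → ℕ
  rest g = ∑.sum (λ j → val g (punchIn a j))
  rest-same : rest f′ ≡ rest f
  rest-same = ∑.sum-cong-≗ (λ j → cong toℕ (updateAt-minimal (punchIn a j) a f (punchInᵢ≢i a j)))
  swap-ends : ∀ x y z → (x + y) + z ≡ (z + y) + x
  swap-ends x y z = trans (+-comm (x + y) z) (trans (cong (z +_) (+-comm x y)) (sym (+-assoc z y x)))

weight-updateAt-≤ : ∀ {n} (f : Labelling n) a (h : Fin 3 → Fin 3) {d} →
  toℕ (h (f a)) ≤ val f a + d → weight (updateAt f a h) ≤ weight f + d
weight-updateAt-≤ f a h {d} bound = +-cancelʳ-≤ (val f a) _ _ (begin
  weight (updateAt f a h) + val f a  ≡⟨ weight-updateAt f a h ⟩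
  weight f + toℕ (h (f a))           ≤⟨ +-monoʳ-≤ (weight f) bound ⟩
  weight f + (val f a + d)           ≡⟨ cong (weight f +_) (+-comm (val f a) d) ⟩
  weight f + (d + val f a)           ≡⟨ +-assoc (weight f) d (val f a) ⟨
  weight f + d + val f a             ∎)
  where open ≤-Reasoning

toℕ≤2 : (c : Fin 3) → toℕ c ≤ 2
toℕ≤2 c = ≤-pred (toℕ<n c)

zero-or-pos : ∀ m → m ≡ 0 ⊎ 0 < m
zero-or-pos zero    = inj₁ refl
zero-or-pos (suc m) = inj₂ (s≤s z≤n)

_≤ᴸ_ : ∀ {n} → Labelling n → Labelling n → Set
g ≤ᴸ f = ∀ x → val g x ≤ val f x

≤ᴸ-trans : ∀ {n} {f g h : Labelling n} → f ≤ᴸ g → g ≤ᴸ h → f ≤ᴸ h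
≤ᴸ-trans p q x = ≤-trans (p x) (q x)

≤ᴸ-updateAt : ∀ {n} (f : Labelling n) a {h : Fin 3 → Fin 3} → (∀ c → toℕ c ≤ toℕ (h c)) →
  f ≤ᴸ updateAt f a h
≤ᴸ-updateAt f a {h} inflationary x with x ≟ a
... | yes refl = subst (val f x ≤_) (sym (val-updateAt-same f x h)) (inflationary (f x))
... | no x≢a   = ≤-reflexive (sym (val-updateAt-other f h x≢a))

atLeastOne : Fin 3 → Fin 3
atLeastOne 0F = 1F
atLeastOne c  = c

atLeastOne-pos : ∀ c → 0 < toℕ (atLeastOne c)
atLeastOne-pos 0F = s≤s z≤n
atLeastOne-pos 1F = s≤s z≤n
atLeastOne-pos 2F = s≤s z≤n

atLeastOne-≥ : ∀ c → toℕ c ≤ toℕ (atLeastOne c)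
atLeastOne-≥ 0F = z≤n
atLeastOne-≥ 1F = ≤-refl
atLeastOne-≥ 2F = ≤-refl

atLeastOne-≤ : ∀ c → toℕ (atLeastOne c) ≤ toℕ c + 1
atLeastOne-≤ 0F = s≤s z≤n
atLeastOne-≤ 1F = s≤s z≤n
atLeastOne-≤ 2F = s≤s (s≤s z≤n)

raise : ∀ {n} → Labelling n → Fin n → Labelling n
raise f a = updateAt f a atLeastOne

raise-pos : ∀ {n} (f : Labelling n) a → 0 < val (raise f a) a
raise-pos f a = subst (0 <_) (sym (val-updateAt-same f a atLeastOne)) (atLeastOne-pos (f a))

≤ᴸ-raise : ∀ {n} (f : Labelling n) a → f ≤ᴸ raise f a
≤ᴸ-raise f a = ≤ᴸ-updateAt f a atLeastOne-≥

raise-keeps-pos : ∀ {n} {g : Labelling n} {x} a → 0 < val g x → 0 < val (raise g a) x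
raise-keeps-pos {g = g} {x} a p = <-≤-trans p (≤ᴸ-raise g a x)

weight-raise : ∀ {n} (f : Labelling n) a → weight (raise f a) ≤ weight f + 1
weight-raise f a = weight-updateAt-≤ f a atLeastOne (atLeastOne-≤ (f a))

raise₂ : ∀ {n} → Labelling n → Fin n → Fin n → Labelling n
raise₂ g a b = raise (raise g a) b

≤ᴸ-raise₂ : ∀ {n} (g : Labelling n) a b → g ≤ᴸ raise₂ g a b
≤ᴸ-raise₂ g a b = ≤ᴸ-trans (≤ᴸ-raise g a) (≤ᴸ-raise (raise g a) b)

raise₂-pos₁ : ∀ {n} (g : Labelling n) a b → 0 < val (raise₂ g a b) a
raise₂-pos₁ g a b = raise-keeps-pos b (raise-pos g a)

raise₂-pos₂ : ∀ {n} (g : Labelling n) a b → 0 < val (raise₂ g a b) b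
raise₂-pos₂ g a b = raise-pos (raise g a) b

raise₂-keeps-pos : ∀ {n} (g : Labelling n) {a b x} → 0 < val g x → 0 < val (raise₂ g a b) x
raise₂-keeps-pos g {a} {b} {x} p = <-≤-trans p (≤ᴸ-raise₂ g a b x)

raise₂-other : ∀ {n} (g : Labelling n) {a b x} → x ≢ a → x ≢ b → val (raise₂ g a b) x ≡ val g x
raise₂-other g {a} x≢a x≢b =
  trans (val-updateAt-other (raise g a) atLeastOne x≢b) (val-updateAt-other g atLeastOne x≢a)

weight-raise₂ : ∀ {n} (g : Labelling n) a b → weight (raise₂ g a b) ≤ weight g + 2
weight-raise₂ g a b = begin
  weight (raise₂ g a b)   ≤⟨ weight-raise (raise g a) b ⟩
  weight (raise g a) + 1  ≤⟨ +-monoˡ-≤ 1 (weight-raise g a) ⟩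
  weight g + 1 + 1        ≡⟨ +-assoc (weight g) 1 1 ⟩
  weight g + 2            ∎
  where open ≤-Reasoning

assignTwo : ∀ {n} → Labelling n → Fin n → Labelling n
assignTwo f a = updateAt f a (const 2F)

assignTwo-two : ∀ {n} (f : Labelling n) a → val (assignTwo f a) a ≡ 2
assignTwo-two f a = val-updateAt-same f a (const 2F)

≤ᴸ-assignTwo : ∀ {n} (f : Labelling n) a → f ≤ᴸ assignTwo f a
≤ᴸ-assignTwo f a = ≤ᴸ-updateAt f a toℕ≤2

weight-assignTwo : ∀ {n} (f : Labelling n) a → weight (assignTwo f a) ≤ weight f + 2
weight-assignTwo f a = weight-updateAt-≤ f a (const 2F) (m≤n+m 2 (val f a))

-- z serves x when z alone witnesses the TRD-condition at x.
record Serves {n} (f : Labelling n) (x z : Fin n) : Set where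
  constructor serves
  field
    dominates : val f x ≡ 0 → val f z ≡ 2
    supports  : 0 < val f x → 0 < val f z

record Served {n} (H : Graph n) (f : Labelling n) (x : Fin n) : Set where
  constructor served-by
  field
    server  : Fin n
    edge    : H x server ≡ true
    serving : Serves f x server

serves-by-two : ∀ {n} {f : Labelling n} {x z} → val f z ≡ 2 → Serves f x z
serves-by-two e = serves (const e) (const (subst (0 <_) (sym e) (s≤s z≤n)))

serves-pos : ∀ {n} {f : Labelling n} {x z} → 0 < val f x → 0 < val f z → Serves f x z
serves-pos x>0 z>0 = serves (λ e → contradiction (subst (0 <_) e x>0) (λ ())) (const z>0)

server-pos : ∀ {n} {f : Labelling n} {x z} → Serves f x z → 0 < val f z
server-pos {f = f} {x} (serves dom sup) with zero-or-pos (val f x)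
... | inj₁ e   = subst (0 <_) (sym (dom e)) (s≤s z≤n)
... | inj₂ x>0 = sup x>0

not-server : ∀ {n} {g : Labelling n} {x z} → val g z ≡ 0 → ¬ Serves g x z
not-server gz≡0 s = contradiction (subst (0 <_) gz≡0 (server-pos s)) (λ ())

Serves-mono : ∀ {n} {g f : Labelling n} {x x′ z z′} → val f x′ ≡ val g x → val g z ≤ val f z′ →
  Serves g x z → Serves f x′ z′
Serves-mono {f = f} {z′ = z′} fx′≡gx gz≤fz′ (serves dom sup) = serves
  (λ e → ≤-antisym (toℕ≤2 (f z′)) (subst (_≤ val f z′) (dom (trans (sym fx′≡gx) e)) gz≤fz′))
  (λ p → <-≤-trans (sup (subst (0 <_) fx′≡gx p)) gz≤fz′)

IsTRDF⇒Served : ∀ {n} {H : Graph n} {f} → IsTRDF H f → ∀ x → Served H f x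
IsTRDF⇒Served {f = f} T x with zero-or-pos (val f x)
... | inj₁ e   = let (z , h , two) = IsTRDF.dominate T x e in served-by z h (serves-by-two two)
... | inj₂ x>0 = let (z , h , z>0) = IsTRDF.total T x x>0 in served-by z h (serves-pos x>0 z>0)

Served⇒IsTRDF : ∀ {n} {H : Graph n} {f} → (∀ x → Served H f x) → IsTRDF H f
Served⇒IsTRDF S = record
  { dominate = λ x e → let served-by z h s = S x in z , h , Serves.dominates s e
  ; total    = λ x p → let served-by z h s = S x in z , h , Serves.supports s p
  }

IsTRDF-local : ∀ {n} {H′ H : Graph n} {g f} → IsTRDF H′ g →
  (∀ x → Served H′ g x → Served H f x) → IsTRDF H f
IsTRDF-local T local = Served⇒IsTRDF (λ x → local x (IsTRDF⇒Served T x))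

Served-transfer : ∀ {n} {H′ H : Graph n} {g f} {x} → Served H′ g x → g ≤ᴸ f → val f x ≡ val g x →
  (∀ {z} → Serves g x z → H′ x z ≡ true → H x z ≡ true) → Served H f x
Served-transfer (served-by z h s) g≤f fx≡gx keep = served-by z (keep s h) (Serves-mono fx≡gx (g≤f z) s)

IsTRDF-≗ : ∀ {n} {H : Graph n} {f f′} → f ≗ f′ → IsTRDF H f → IsTRDF H f′
IsTRDF-≗ f≗f′ T = IsTRDF-local T (λ x (served-by z h s) →
  served-by z h (Serves-mono (cong toℕ (sym (f≗f′ x))) (≤-reflexive (cong toℕ (f≗f′ z))) s))

IsTRDF-permute : ∀ {n} {G : Graph n} {f} (π : Permutation′ n) →
  (∀ x z → G (π ⟨$⟩ʳ x) (π ⟨$⟩ʳ z) ≡ G x z) → IsTRDF G f → IsTRDF G (f ∘ (π ⟨$⟩ʳ_))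
IsTRDF-permute {G = G} {f} π automorphism T = Served⇒IsTRDF λ x →
  let served-by z πx-z serves-πx = IsTRDF⇒Served T (π ⟨$⟩ʳ x) in
  served-by (π ⟨$⟩ˡ z)
    (trans (sym (automorphism x (π ⟨$⟩ˡ z))) (trans (cong (G (π ⟨$⟩ʳ x)) (inverseʳ π)) πx-z))
    (Serves-mono refl (≤-reflexive (cong (val f) (sym (inverseʳ π)))) serves-πx)

_⊆ᴳ_ : ∀ {n} → Graph n → Graph n → Set
H ⊆ᴳ G = ∀ {x z} → H x z ≡ true → G x z ≡ true

IsTRDF-mono : ∀ {n} {H G : Graph n} {f} → H ⊆ᴳ G → IsTRDF H f → IsTRDF G f
IsTRDF-mono H⊆G T = IsTRDF-local T (λ x (served-by z h s) → served-by z (H⊆G h) s)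

Joins : ∀ {n} → Fin n → Fin n → Fin n → Fin n → Set
Joins x z p q = (x ≡ p × z ≡ q) ⊎ (x ≡ q × z ≡ p)

joins? : ∀ {n} (x z p q : Fin n) → Dec (Joins x z p q)
joins? x z p q = (x ≟ p ×-dec z ≟ q) ⊎-dec (x ≟ q ×-dec z ≟ p)

¬Joins-from : ∀ {n} {x z p q : Fin n} → x ≢ p → x ≢ q → ¬ Joins x z p q
¬Joins-from x≢p x≢q = [ x≢p ∘ proj₁ , x≢q ∘ proj₁ ]

¬Joins-to : ∀ {n} {x z p q : Fin n} → z ≢ p → z ≢ q → ¬ Joins x z p q
¬Joins-to z≢p z≢q = [ z≢q ∘ proj₂ , z≢p ∘ proj₂ ]

¬Joins-serving : ∀ {n} {g : Labelling n} {x z p q} → Serves g x z →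
  x ≢ p ⊎ val g q ≡ 0 → x ≢ q ⊎ val g p ≡ 0 → ¬ Joins x z p q
¬Joins-serving s c₁ c₂ (inj₁ (refl , refl)) = [ (λ x≢p → x≢p refl) , (λ gq≡0 → not-server gq≡0 s) ] c₁
¬Joins-serving s c₁ c₂ (inj₂ (refl , refl)) = [ (λ x≢q → x≢q refl) , (λ gp≡0 → not-server gp≡0 s) ] c₂

joinTest : ∀ {n} (x z p q : Fin n) → Bool
joinTest x z p q = (⌊ x ≟ p ⌋ ∧ ⌊ z ≟ q ⌋) ∨ (⌊ x ≟ q ⌋ ∧ ⌊ z ≟ p ⌋)

joinTest-sound : ∀ {n} {x z p q : Fin n} → joinTest x z p q ≡ true → Joins x z p q
joinTest-sound {x = x} {z} {p} {q} e with Equivalence.to T-∨ (Equivalence.from T-≡ e)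
... | inj₁ t = let (s , r) = Equivalence.to T-∧ t in
  inj₁ (toWitness {a? = x ≟ p} s , toWitness {a? = z ≟ q} r)
... | inj₂ t = let (s , r) = Equivalence.to T-∧ t in
  inj₂ (toWitness {a? = x ≟ q} s , toWitness {a? = z ≟ p} r)

addEdge-cases : ∀ {n} (G : Graph n) {a b x z} → addEdge G a b x z ≡ true →
  G x z ≡ true ⊎ Joins x z a b
addEdge-cases G e with Equivalence.to T-∨ (Equivalence.from T-≡ e)
... | inj₁ t = inj₁ (Equivalence.to T-≡ t)
... | inj₂ t = inj₂ (joinTest-sound (Equivalence.to T-≡ t))

⊆-addEdge : ∀ {n} (G : Graph n) a b → G ⊆ᴳ addEdge G a b
⊆-addEdge G a b e rewrite e = refl

addEdge-comm : ∀ {n} (G : Graph n) a b → addEdge G a b ⊆ᴳ addEdge G b a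
addEdge-comm G a b {x} {z} e = trans (cong (G x z ∨_) (∨-comm (⌊ x ≟ b ⌋ ∧ ⌊ z ≟ a ⌋) _)) e

removeEdge-⊆ : ∀ {n} (G : Graph n) u v → removeEdge G u v ⊆ᴳ G
removeEdge-⊆ G u v {x} {z} e with G x z
... | true  = refl
... | false = e

removeEdge-keeps : ∀ {n} (G : Graph n) {u v x z} → G x z ≡ true → ¬ Joins x z u v →
  removeEdge G u v x z ≡ true
removeEdge-keeps G e ¬j = cong₂ (λ p q → p ∧ not q) e (¬-not (¬j ∘ joinTest-sound))

removeEdge-comm : ∀ {n} (G : Graph n) u v → removeEdge G u v ⊆ᴳ removeEdge G v u
removeEdge-comm G u v {x} {z} e = trans (cong (λ b → G x z ∧ not b) (∨-comm (⌊ x ≟ v ⌋ ∧ ⌊ z ≟ u ⌋) _)) e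

addEdge→removeEdge : ∀ {n} (G : Graph n) {a b u v x z} → addEdge G a b x z ≡ true →
  ¬ Joins x z a b → ¬ Joins x z u v → removeEdge G u v x z ≡ true
addEdge→removeEdge G e ¬ab ¬uv =
  [ (λ xz → removeEdge-keeps G xz ¬uv) , (λ j → contradiction j ¬ab) ] (addEdge-cases G e)

addEdge-zero-ends : ∀ {n} {G : Graph n} {a b g} → IsTRDF (addEdge G a b) g →
  val g a ≡ 0 → val g b ≡ 0 → IsTRDF G g
addEdge-zero-ends {G = G} T ga≡0 gb≡0 = IsTRDF-local T λ x served →
  Served-transfer served (λ _ → ≤-refl) refl λ s e →
    [ id , (λ j → contradiction j (¬Joins-serving s (inj₂ gb≡0) (inj₂ ga≡0))) ] (addEdge-cases G e)

twins-or-distinguished : ∀ {n} (G : Graph n) s t →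
  (∀ x → x ≢ s → x ≢ t → G s x ≡ G t x) ⊎ ∃ λ x → x ≢ s × x ≢ t × G s x ≢ G t x
twins-or-distinguished G s t with any? (λ x → ¬? (x ≟ s) ×-dec ¬? (x ≟ t) ×-dec ¬? (G s x Bool.≟ G t x))
... | yes found = inj₂ found
... | no none = inj₁ λ x x≢s x≢t →
  decidable-stable (G s x Bool.≟ G t x) (λ differ → none (x , x≢s , x≢t , differ))

distinct-bools : ∀ {b c : Bool} → b ≢ c → (b ≡ true × c ≡ false) ⊎ (b ≡ false × c ≡ true)
distinct-bools {true}  {true}  b≢c = contradiction refl b≢c
distinct-bools {true}  {false} _   = inj₁ (refl , refl)
distinct-bools {false} {true}  _   = inj₂ (refl , refl)
distinct-bools {false} {false} b≢c = contradiction refl b≢c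

length-≤1 : ∀ {A : Set} {v : A} {xs : List A} → Unique xs → All (_≡ v) xs → length xs ≤ 1
length-≤1 [] [] = z≤n
length-≤1 ([] ∷ []) (_ ∷ []) = s≤s z≤n
length-≤1 ((a≢b ∷ _) ∷ _) (a≡v ∷ b≡v ∷ _) = contradiction (trans a≡v (sym b≡v)) a≢b

other-neighbour : ∀ {n} (G : Graph n) {x} → 2 ≤ deg G x → ∀ v → ∃ λ w → G x w ≡ true × w ≢ v
other-neighbour {n} G {x} 2≤deg v with any? (λ w → (G x w Bool.≟ true) ×-dec ¬? (w ≟ v))
... | yes found = found
... | no none = contradiction 2≤deg (<⇒≱ (s≤s (length-≤1
        (Unique.filter⁺ adjacent? (Unique.allFin⁺ n))
        (All.map only-v (all-filter adjacent? (allFin n))))))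
  where
  adjacent? = λ w → G x w Bool.≟ true
  only-v : ∀ {w} → G x w ≡ true → w ≡ v
  only-v {w} xw with w ≟ v
  ... | yes w≡v = w≡v
  ... | no w≢v  = contradiction (w , xw , w≢v) none

-- Existence of γtR-functions

IsTRDF? : ∀ {n} (H : Graph n) f → Dec (IsTRDF H f)
IsTRDF? H f = map′ (λ (d , t) → record { dominate = d ; total = t })
  (λ T → IsTRDF.dominate T , IsTRDF.total T)
  (all? (λ x → (val f x ℕ.≟ 0) →-dec any? (λ z → (H x z Bool.≟ true) ×-dec (val f z ℕ.≟ 2)))
   ×-dec all? (λ x → (0 <? val f x) →-dec any? (λ z → (H x z Bool.≟ true) ×-dec (0 <? val f z))))

-- Every labelling agrees pointwise with one of finToFun i, i : Fin (3 ^ n); take the lightest such TRDF.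
γtR-exists : ∀ {n} (H : Graph n) {f₀} → IsTRDF H f₀ → ∃ (IsγtR H)
γtR-exists {n} H {f₀} T₀ = weight best , (best , best-TRDF , refl) , best-minimal
  where
  candidates = filter (IsTRDF? H) (tabulate (finToFun {3} {n}))
  best = argmin weight f₀ candidates
  best-TRDF : IsTRDF H best
  best-TRDF = argmin-all weight T₀ (all-filter (IsTRDF? H) (tabulate finToFun))
  best-minimal : ∀ f → IsTRDF H f → weight best ≤ weight f
  best-minimal f T = subst (weight best ≤_) (weight-≗ (finToFun-funToFin f))
    (All.lookup (f[argmin]≤f[xs] {f = weight} f₀ candidates)
      (∈-filter⁺ (IsTRDF? H) (∈-tabulate⁺ (funToFin f)) (IsTRDF-≗ (sym ∘ finToFun-funToFin f) T)))

-- Transpositions and simple graphs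

data Transposed {n} (i j : Fin n) : Fin n → Fin n → Set where
  at-i : Transposed i j i j
  at-j : Transposed i j j i
  away : ∀ {k} → k ≢ i → k ≢ j → Transposed i j k k

transposed : ∀ {n} (i j k : Fin n) → Transposed i j k (PC.transpose i j k)
transposed i j k with k ≟ i
... | yes refl = at-i
... | no k≢i with k ≟ j
...   | yes refl = at-j
...   | no k≢j   = away k≢i k≢j

Transposed-i : ∀ {n} {i j k : Fin n} → Transposed i j i k → k ≡ j
Transposed-i at-i = refl
Transposed-i at-j = refl
Transposed-i (away i≢i _) = contradiction refl i≢i

Transposed-j : ∀ {n} {i j k : Fin n} → Transposed i j j k → k ≡ i
Transposed-j at-i = refl
Transposed-j at-j = refl
Transposed-j (away _ j≢j) = contradiction refl j≢j

Transposed-away : ∀ {n} {i j k k′ : Fin n} → k ≢ i → k ≢ j → Transposed i j k k′ → k′ ≡ k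
Transposed-away k≢i _ at-i = contradiction refl k≢i
Transposed-away _ k≢j at-j = contradiction refl k≢j
Transposed-away _ _ (away _ _) = refl

module Simple {n} {G : Graph n} (simple : IsSimple G) where

  adjacent-sym : ∀ {x z} → G x z ≡ true → G z x ≡ true
  adjacent-sym {x} {z} e = trans (IsSimple.symm simple z x) e

  adjacent⇒≢ : ∀ {x z} → G x z ≡ true → x ≢ z
  adjacent⇒≢ {x} e refl = contradiction (trans (sym e) (IsSimple.irrefl simple x)) (λ ())

  -- The case splits go through Dec arguments: a `with` on x ≟ a would also abstract the x ≟ a
  -- hidden inside addEdge G a b in the type of the served hypothesis.
  addEdge-positive-ends : ∀ {a b c g} → G a c ≡ true → G b c ≡ true → IsTRDF (addEdge G a b) g →
    0 < val g a → 0 < val g b → IsTRDF G (raise g c)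
  addEdge-positive-ends {a} {b} {c} {g} ac bc T ga>0 gb>0 =
    IsTRDF-local T (λ x → local (x ≟ a) (x ≟ b) (x ≟ c))
    where
    local : ∀ {x} → Dec (x ≡ a) → Dec (x ≡ b) → Dec (x ≡ c) →
      Served (addEdge G a b) g x → Served G (raise g c) x
    local (yes refl) _ _ _ = served-by c ac (serves-pos (raise-keeps-pos c ga>0) (raise-pos g c))
    local (no _) (yes refl) _ _ = served-by c bc (serves-pos (raise-keeps-pos c gb>0) (raise-pos g c))
    local (no _) (no _) (yes refl) _ =
      served-by a (adjacent-sym ac) (serves-pos (raise-pos g c) (raise-keeps-pos c ga>0))
    local (no x≢a) (no x≢b) (no x≢c) served =
      Served-transfer served (≤ᴸ-raise g c) (val-updateAt-other g atLeastOne x≢c)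
      (λ _ e → [ id , (λ j → contradiction j (¬Joins-from x≢a x≢b)) ] (addEdge-cases G e))

  repair-at-zero : ∀ {a b u v w g} → G u w ≡ true → w ≢ v → IsTRDF (addEdge G a b) g → val g u ≡ 0 →
    (∀ {x z} → x ≢ u → x ≢ w → Serves g x z → ¬ Joins x z a b) →
    IsTRDF (removeEdge G u v) (raise₂ g u w)
  repair-at-zero {a} {b} {u} {v} {w} {g} uw w≢v T gu≡0 added-unused =
    IsTRDF-local T (λ x → local (x ≟ u) (x ≟ w))
    where
    w≢u = adjacent⇒≢ (adjacent-sym uw)
    local : ∀ {x} → Dec (x ≡ u) → Dec (x ≡ w) →
      Served (addEdge G a b) g x → Served (removeEdge G u v) (raise₂ g u w) x
    local (yes refl) _ _ = served-by w (removeEdge-keeps G uw (¬Joins-to w≢u w≢v))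
      (serves-pos (raise₂-pos₁ g u w) (raise₂-pos₂ g u w))
    local (no _) (yes refl) _ = served-by u (removeEdge-keeps G (adjacent-sym uw) (¬Joins-from w≢u w≢v))
      (serves-pos (raise₂-pos₂ g u w) (raise₂-pos₁ g u w))
    local (no x≢u) (no x≢w) served = Served-transfer served (≤ᴸ-raise₂ g u w) (raise₂-other g x≢u x≢w)
      (λ s e → addEdge→removeEdge G e (added-unused x≢u x≢w s) (¬Joins-serving s (inj₁ x≢u) (inj₂ gu≡0)))

  repair-matching : ∀ {a b u v u′ v′ g f} → IsTRDF (addEdge G a b) g → g ≤ᴸ f →
    G u u′ ≡ true → G v v′ ≡ true → u′ ≢ v → v′ ≢ u →
    0 < val f u → 0 < val f v → 0 < val f u′ → 0 < val f v′ →
    (∀ {x} → x ≢ u → x ≢ v → x ≢ u′ → x ≢ v′ → val f x ≡ val g x × x ≢ a × x ≢ b) →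
    IsTRDF (removeEdge G u v) f
  repair-matching {a} {b} {u} {v} {u′} {v′} {g} {f} T g≤f uu′ vv′ u′≢v v′≢u fu fv fu′ fv′ others =
    IsTRDF-local T (λ x → local (x ≟ u) (x ≟ v) (x ≟ u′) (x ≟ v′))
    where
    u′≢u = adjacent⇒≢ (adjacent-sym uu′)
    v′≢v = adjacent⇒≢ (adjacent-sym vv′)
    local : ∀ {x} → Dec (x ≡ u) → Dec (x ≡ v) → Dec (x ≡ u′) → Dec (x ≡ v′) →
      Served (addEdge G a b) g x → Served (removeEdge G u v) f x
    local (yes refl) _ _ _ _ =
      served-by u′ (removeEdge-keeps G uu′ (¬Joins-to u′≢u u′≢v)) (serves-pos fu fu′)
    local (no _) (yes refl) _ _ _ =
      served-by v′ (removeEdge-keeps G vv′ (¬Joins-to v′≢u v′≢v)) (serves-pos fv fv′)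
    local (no _) (no _) (yes refl) _ _ =
      served-by u (removeEdge-keeps G (adjacent-sym uu′) (¬Joins-from u′≢u u′≢v)) (serves-pos fu′ fu)
    local (no _) (no _) (no _) (yes refl) _ =
      served-by v (removeEdge-keeps G (adjacent-sym vv′) (¬Joins-from v′≢u v′≢v)) (serves-pos fv′ fv)
    local (no x≢u) (no x≢v) (no x≢u′) (no x≢v′) served =
      let (fx≡gx , x≢a , x≢b) = others x≢u x≢v x≢u′ x≢v′ in
      Served-transfer served g≤f fx≡gx
        (λ _ e → addEdge→removeEdge G e (¬Joins-from x≢a x≢b) (¬Joins-from x≢u x≢v))

  repair-by-two : ∀ {u v y s g} → G u s ≡ true → G v s ≡ true → G y s ≡ true →
    IsTRDF (addEdge G u y) g → 0 < val g u → IsTRDF (removeEdge G u v) (assignTwo g s)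
  repair-by-two {u} {v} {y} {s} {g} us vs ys T gu>0 =
    IsTRDF-local T (λ x → local (x ≟ s) (x ≟ u) (x ≟ v) (x ≟ y))
    where
    s≢u = adjacent⇒≢ (adjacent-sym us)
    s≢v = adjacent⇒≢ (adjacent-sym vs)
    f = assignTwo g s
    by-s : ∀ {x} → G x s ≡ true → Served (removeEdge G u v) f x
    by-s xs = served-by s (removeEdge-keeps G xs (¬Joins-to s≢u s≢v)) (serves-by-two (assignTwo-two g s))
    local : ∀ {x} → Dec (x ≡ s) → Dec (x ≡ u) → Dec (x ≡ v) → Dec (x ≡ y) →
      Served (addEdge G u y) g x → Served (removeEdge G u v) f x
    local (yes refl) _ _ _ _ = served-by u (removeEdge-keeps G (adjacent-sym us) (¬Joins-from s≢u s≢v))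
      (serves-pos (<-≤-trans (s≤s z≤n) (≤-reflexive (sym (assignTwo-two g s))))
                  (<-≤-trans gu>0 (≤ᴸ-assignTwo g s u)))
    local (no _) (yes refl) _ _ _ = by-s us
    local (no _) (no _) (yes refl) _ _ = by-s vs
    local (no _) (no _) (no _) (yes refl) _ = by-s ys
    local (no x≢s) (no x≢u) (no x≢v) (no x≢y) served =
      Served-transfer served (≤ᴸ-assignTwo g s) (val-updateAt-other g _ x≢s)
      (λ _ e → addEdge→removeEdge G e (¬Joins-from x≢u x≢y) (¬Joins-from x≢u x≢v))

  removeEdge-preserves-TRDF : ∀ {u v s f} → G u s ≡ true → G v s ≡ true →
    val f u ≤ val f s → val f v ≤ val f s → IsTRDF G f → IsTRDF (removeEdge G u v) f
  removeEdge-preserves-TRDF {u} {v} {s} us vs fu≤fs fv≤fs T = IsTRDF-local T local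
    where
    s≢u = adjacent⇒≢ (adjacent-sym us)
    s≢v = adjacent⇒≢ (adjacent-sym vs)
    local : ∀ x → Served G _ x → Served (removeEdge G u v) _ x
    local x (served-by z xz xz-serves) with joins? x z u v
    ... | no ¬j = served-by z (removeEdge-keeps G xz ¬j) xz-serves
    ... | yes (inj₁ (refl , refl)) =
      served-by s (removeEdge-keeps G us (¬Joins-to s≢u s≢v)) (Serves-mono refl fv≤fs xz-serves)
    ... | yes (inj₂ (refl , refl)) =
      served-by s (removeEdge-keeps G vs (¬Joins-to s≢u s≢v)) (Serves-mono refl fu≤fs xz-serves)

  ClosedTwins : Fin n → Fin n → Set
  ClosedTwins s t = G s t ≡ true × (∀ x → x ≢ s → x ≢ t → G s x ≡ G t x)

  ClosedTwins-sym : ∀ {s t} → ClosedTwins s t → ClosedTwins t s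
  ClosedTwins-sym (st , agree) = adjacent-sym st , λ x x≢t x≢s → sym (agree x x≢s x≢t)

  ClosedTwins-trans : ∀ {s t u} → ClosedTwins s t → ClosedTwins t u → s ≢ u → ClosedTwins s u
  ClosedTwins-trans {s} {t} {u} (st , st-agree) (tu , tu-agree) s≢u = su , su-agree
    where
    u≢t = adjacent⇒≢ (adjacent-sym tu)
    su = trans (st-agree u (s≢u ∘ sym) u≢t) tu
    su-agree : ∀ x → x ≢ s → x ≢ u → G s x ≡ G u x
    su-agree x x≢s x≢u with x ≟ t
    ... | yes refl = trans st (sym (adjacent-sym tu))
    ... | no x≢t = trans (st-agree x x≢s x≢t) (tu-agree x x≢t x≢u)

  twin-transpose-automorphism : ∀ {s t} → ClosedTwins s t →
    ∀ x z → G (transpose s t ⟨$⟩ʳ x) (transpose s t ⟨$⟩ʳ z) ≡ G x z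
  twin-transpose-automorphism {s} {t} (st , twin) x z = go (transposed s t x) (transposed s t z)
    where
    irrefl = IsSimple.irrefl simple
    symm = IsSimple.symm simple
    go : ∀ {x x′ z z′} → Transposed s t x x′ → Transposed s t z z′ → G x′ z′ ≡ G x z
    go at-i at-i = trans (irrefl t) (sym (irrefl s))
    go at-i at-j = symm t s
    go at-i (away z≢s z≢t) = sym (twin _ z≢s z≢t)
    go at-j at-i = symm s t
    go at-j at-j = trans (irrefl s) (sym (irrefl t))
    go at-j (away z≢s z≢t) = twin _ z≢s z≢t
    go (away x≢s x≢t) at-i = trans (symm _ t) (trans (sym (twin _ x≢s x≢t)) (symm s _))
    go (away x≢s x≢t) at-j = trans (symm _ s) (trans (twin _ x≢s x≢t) (symm t _))
    go (away _ _) (away _ _) = refl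

  twin-max : ∀ {s t f} → ClosedTwins s t → IsTRDF G f →
    ∃ λ f′ → IsTRDF G f′ × weight f′ ≡ weight f × val f′ t ≤ val f′ s × val f s ≤ val f′ s ×
             (∀ x → x ≢ s → x ≢ t → val f′ x ≡ val f x)
  twin-max {s} {t} {f} twins T with val f t ≤? val f s
  ... | yes ft≤fs = f , T , refl , ft≤fs , ≤-refl , λ _ _ _ → refl
  ... | no ft≰fs = f ∘ τ , IsTRDF-permute π (twin-transpose-automorphism twins) T , weight-permute f π ,
        subst₂ _≤_ (cong (val f) (sym τt)) (cong (val f) (sym τs)) fs≤ft ,
        subst (val f s ≤_) (cong (val f) (sym τs)) fs≤ft ,
        λ x x≢s x≢t → cong (val f) (τ-away x≢s x≢t)
    where
    π = transpose s t
    τ = π ⟨$⟩ʳ_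
    fs≤ft = <⇒≤ (≰⇒> ft≰fs)
    τs : τ s ≡ t
    τs = Transposed-i (transposed s t s)
    τt : τ t ≡ s
    τt = Transposed-j (transposed s t t)
    τ-away : ∀ {x} → x ≢ s → x ≢ t → τ x ≡ x
    τ-away x≢s x≢t = Transposed-away x≢s x≢t (transposed s t _)

  twin-triangle-removal : ∀ {u v s f} → G u v ≡ true → ClosedTwins s u → ClosedTwins s v → IsTRDF G f →
    ∃ λ f′ → IsTRDF (removeEdge G u v) f′ × weight f′ ≡ weight f
  twin-triangle-removal {u} {v} {s} uv su-twins sv-twins T =
    let (f₁ , T₁ , w₁ , f₁v≤f₁s , _ , _) = twin-max sv-twins T
        (f₂ , T₂ , w₂ , f₂u≤f₂s , f₁s≤f₂s , f₂-away) = twin-max su-twins T₁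
        f₂v≤f₂s = ≤-trans (≤-reflexive (f₂-away v v≢s (adjacent⇒≢ (adjacent-sym uv))))
                          (≤-trans f₁v≤f₁s f₁s≤f₂s)
    in f₂ , removeEdge-preserves-TRDF us vs f₂u≤f₂s f₂v≤f₂s T₂ , trans w₂ w₁
    where
    us = adjacent-sym (proj₁ su-twins)
    vs = adjacent-sym (proj₁ sv-twins)
    v≢s = adjacent⇒≢ vs

-- The supercritical case

BoundedTRDF : ∀ {n} → Graph n → ℕ → Set
BoundedTRDF {n} H m = ∃ λ (f : Labelling n) → IsTRDF H f × weight f ≤ m

module Supercritical {n} {G : Graph n} (simple : IsSimple G) (minDeg : MinDegAtLeast G 2)
  {k} (γ : IsγtR G k)
  (critical : ∀ (a b : Fin n) → a ≢ b → G a b ≡ false →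
     ∀ k k′ → IsγtR G k → IsγtR (addEdge G a b) k′ → k′ + 2 ≤ k)
  where

  open Simple simple

  no-TRDF-below : ∀ {f w} → IsTRDF G f → weight f ≤ w + 1 → w + 2 ≤ k → ⊥
  no-TRDF-below {f} {w} T f≤w+1 w+2≤k =
    <⇒≱ (≤-trans (s≤s f≤w+1) (subst (_≤ k) (+-suc w 1) w+2≤k)) (proj₂ γ f T)

  addEdge-saves-two : ∀ {a b} → a ≢ b → G a b ≡ false → ∃ λ g → IsTRDF (addEdge G a b) g × weight g + 2 ≤ k
  addEdge-saves-two {a} {b} a≢b ab≡false =
    let (k′ , γ′) = γtR-exists (addEdge G a b) all-ones
        (g , T , g≡k′) = proj₁ γ′
    in g , T , subst (λ w → w + 2 ≤ k) (sym g≡k′) (critical a b a≢b ab≡false k k′ γ γ′)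
    where
    all-ones : IsTRDF (addEdge G a b) (const 1F)
    all-ones = Served⇒IsTRDF λ x → let (z , xz , _) = other-neighbour G (minDeg x) x in
      served-by z (⊆-addEdge G a b xz) (serves-pos (s≤s z≤n) (s≤s z≤n))

  exactly-one-end-zero : ∀ {a b c g} → G a c ≡ true → G b c ≡ true → IsTRDF (addEdge G a b) g →
    weight g + 2 ≤ k → (val g a ≡ 0 × 0 < val g b) ⊎ (0 < val g a × val g b ≡ 0)
  exactly-one-end-zero {a} {b} {c} {g} ac bc T budget with zero-or-pos (val g a) | zero-or-pos (val g b)
  ... | inj₁ ga≡0 | inj₁ gb≡0 =
    contradiction budget (no-TRDF-below (addEdge-zero-ends T ga≡0 gb≡0) (m≤m+n _ 1))
  ... | inj₁ ga≡0 | inj₂ gb>0 = inj₁ (ga≡0 , gb>0)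
  ... | inj₂ ga>0 | inj₁ gb≡0 = inj₂ (ga>0 , gb≡0)
  ... | inj₂ ga>0 | inj₂ gb>0 =
    contradiction budget (no-TRDF-below (addEdge-positive-ends ac bc T ga>0 gb>0) (weight-raise g c))

  removable-private-neighbour : ∀ {u v y} → G u v ≡ true → G v y ≡ true → G u y ≡ false → u ≢ y →
    BoundedTRDF (removeEdge G u v) k
  removable-private-neighbour {u} {v} {y} uv vy uy≡false u≢y
    with addEdge-saves-two u≢y uy≡false | other-neighbour G (minDeg u) v
  ... | g , T , budget | w , uw , w≢v with zero-or-pos (val g u)
  ...   | inj₁ gu≡0 = raise₂ g u w ,
          repair-at-zero uw w≢v T gu≡0 (λ x≢u _ s → ¬Joins-serving s (inj₁ x≢u) (inj₂ gu≡0)) ,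
          ≤-trans (weight-raise₂ g u w) budget
  ...   | inj₂ gu>0 with zero-or-pos (val g v)
  ...     | inj₂ gv>0 = raise₂ g y w ,
          repair-matching T (≤ᴸ-raise₂ g y w) uw vy w≢v (u≢y ∘ sym)
            (raise₂-keeps-pos g gu>0) (raise₂-keeps-pos g gv>0) (raise₂-pos₂ g y w) (raise₂-pos₁ g y w)
            (λ x≢u _ x≢w x≢y → raise₂-other g x≢y x≢w , x≢u , x≢y) ,
          ≤-trans (weight-raise₂ g y w) budget
  ...     | inj₁ gv≡0 with exactly-one-end-zero uv (adjacent-sym vy) T budget
  ...       | inj₁ (gu≡0 , _) = contradiction gu≡0 (>⇒≢ gu>0)
  ...       | inj₂ (_ , gy≡0) = raise₂ g v y ,
          IsTRDF-mono (removeEdge-comm G v u)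
            (repair-at-zero vy (u≢y ∘ sym) T gv≡0 (λ _ x≢y s → ¬Joins-serving s (inj₂ gy≡0) (inj₁ x≢y))) ,
          ≤-trans (weight-raise₂ g v y) budget

  removable-via-common-neighbour : ∀ {u v s y} → G u s ≡ true → G v s ≡ true → G y s ≡ true →
    G u y ≡ false → u ≢ y → BoundedTRDF (removeEdge G u v) k
  removable-via-common-neighbour {u} {v} {s} {y} us vs ys uy≡false u≢y with addEdge-saves-two u≢y uy≡false
  ... | g , T , budget with zero-or-pos (val g u)
  ...   | inj₁ gu≡0 = raise₂ g u s ,
          repair-at-zero us (adjacent⇒≢ (adjacent-sym vs)) T gu≡0
            (λ x≢u _ z → ¬Joins-serving z (inj₁ x≢u) (inj₂ gu≡0)) ,
          ≤-trans (weight-raise₂ g u s) budget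
  ...   | inj₂ gu>0 = assignTwo g s , repair-by-two us vs ys T gu>0 , ≤-trans (weight-assignTwo g s) budget

  removable-via-common-neighbours-of-cheap-edge : ∀ {u v a b g} → G u a ≡ true → G u b ≡ true →
    G v a ≡ true → G v b ≡ true → IsTRDF (addEdge G a b) g → weight g + 2 ≤ k →
    0 < val g a → val g b ≡ 0 → BoundedTRDF (removeEdge G u v) k
  removable-via-common-neighbours-of-cheap-edge {u} {v} {a} {b} {g} ua ub va vb T budget ga>0 gb≡0
    with zero-or-pos (val g u)
  ... | inj₁ gu≡0 = raise₂ g u b ,
        repair-at-zero ub (adjacent⇒≢ (adjacent-sym vb)) T gu≡0
          (λ _ x≢b s → ¬Joins-serving s (inj₂ gb≡0) (inj₁ x≢b)) ,
        ≤-trans (weight-raise₂ g u b) budget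
  ... | inj₂ gu>0 = raise₂ g b v ,
        repair-matching T (≤ᴸ-raise₂ g b v) ua vb
          (adjacent⇒≢ (adjacent-sym va)) (adjacent⇒≢ (adjacent-sym ub))
          (raise₂-keeps-pos g gu>0) (raise₂-pos₂ g b v) (raise₂-keeps-pos g ga>0) (raise₂-pos₁ g b v)
          (λ _ x≢v x≢a x≢b → raise₂-other g x≢b x≢v , x≢a , x≢b) ,
        ≤-trans (weight-raise₂ g b v) budget

  removable-via-nonadjacent-common-neighbours : ∀ {u v a b} → G u a ≡ true → G u b ≡ true →
    G v a ≡ true → G v b ≡ true → a ≢ b → G a b ≡ false → BoundedTRDF (removeEdge G u v) k
  removable-via-nonadjacent-common-neighbours {u} {v} {a} {b} ua ub va vb a≢b ab≡false
    with addEdge-saves-two a≢b ab≡false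
  ... | g , T , budget with exactly-one-end-zero (adjacent-sym ua) (adjacent-sym ub) T budget
  ...   | inj₂ (ga>0 , gb≡0) = removable-via-common-neighbours-of-cheap-edge ua ub va vb T budget ga>0 gb≡0
  ...   | inj₁ (ga≡0 , gb>0) = removable-via-common-neighbours-of-cheap-edge ub ua vb va
          (IsTRDF-mono (addEdge-comm G a b) T) budget gb>0 ga≡0

  removable-in-twin-triangle : ∀ {u v s} → G u v ≡ true → ClosedTwins s u → ClosedTwins s v →
    BoundedTRDF (removeEdge G u v) k
  removable-in-twin-triangle uv su-twins sv-twins =
    let (f , T , f≡k) = proj₁ γ
        (f′ , T′ , f′≡f) = twin-triangle-removal uv su-twins sv-twins T
    in f′ , T′ , ≤-reflexive (trans f′≡f f≡k)

  removable-with-twin-ends : ∀ {u v s} → ClosedTwins u v → G u s ≡ true → G v s ≡ true →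
    BoundedTRDF (removeEdge G u v) k
  removable-with-twin-ends {u} {v} {s} uv-twins@(uv , uv-agree) us vs with twins-or-distinguished G s v
  ... | inj₁ sv-agree = removable-in-twin-triangle uv
          (ClosedTwins-trans sv-twins (ClosedTwins-sym uv-twins) (adjacent⇒≢ (adjacent-sym us))) sv-twins
    where sv-twins = adjacent-sym vs , sv-agree
  ... | inj₂ (x , x≢s , x≢v , differ) = by-distinguisher (distinct-bools differ)
    where
    x≢u : x ≢ u
    x≢u refl = differ (trans (adjacent-sym us) (sym (adjacent-sym uv)))
    ux≡vx = uv-agree x x≢u x≢v
    by-distinguisher : (G s x ≡ true × G v x ≡ false) ⊎ (G s x ≡ false × G v x ≡ true) →
      BoundedTRDF (removeEdge G u v) k
    by-distinguisher (inj₁ (sx , vx≡false)) =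
      removable-via-common-neighbour us vs (adjacent-sym sx) (trans ux≡vx vx≡false) (x≢u ∘ sym)
    by-distinguisher (inj₂ (sx≡false , vx)) =
      removable-via-nonadjacent-common-neighbours us (trans ux≡vx vx) vs vx (x≢s ∘ sym) sx≡false

  removable : ∀ {u v} → G u v ≡ true → BoundedTRDF (removeEdge G u v) k
  removable {u} {v} uv with twins-or-distinguished G u v
  ... | inj₂ (x , x≢u , x≢v , differ) with distinct-bools differ
  ...   | inj₁ (ux , vx≡false) =
          let (f , T , f≤k) = removable-private-neighbour (adjacent-sym uv) ux vx≡false (x≢v ∘ sym)
          in f , IsTRDF-mono (removeEdge-comm G v u) T , f≤k
  ...   | inj₂ (ux≡false , vx) = removable-private-neighbour uv vx ux≡false (x≢u ∘ sym)
  removable {u} {v} uv | inj₁ uv-agree =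
    let (s , us , s≢v) = other-neighbour G (minDeg u) v
        vs = trans (sym (uv-agree s (adjacent⇒≢ (adjacent-sym us)) s≢v)) us
    in removable-with-twin-ends (uv , uv-agree) us vs

corollary9p4 : ∀ (n : ℕ) (G : Graph n) → IsSimple G → MinDegAtLeast G 2 →
    IsSupercritical G →
    ∀ (u v : Fin n) → G u v ≡ true →
    ∀ (k : ℕ) → IsγtR G k → IsγtR (removeEdge G u v) k
corollary9p4 n G simple minDeg (_ , critical) u v uv k γ =
  let (f , T , f≤k) = Supercritical.removable simple minDeg γ critical uv
  in (f , T , ≤-antisym f≤k (k≤ f T)) , k≤
  where
  k≤ : ∀ f → IsTRDF (removeEdge G u v) f → k ≤ weight f
  k≤ f T = proj₂ γ f (IsTRDF-mono (removeEdge-⊆ G u v) T)
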